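{- Let $(\mathcal{R},W)$ be a Strip Packing instance, let $\mathcal{F},\mathcal{Q},\mathcal{W}$ be its $\mathcal{FQW}$-partition, and run the Bottom-Left algorithm with the $\mathcal{FQW}$-ordering. If $\mathcal{Q}=\emptyset$ or $\max\{y_r+h_r: r\in\mathcal{Q}\}\le h_{\max}$, then $h_{\mathrm{BL}}\le 2h_{\mathrm{OPT}}$.
   Context: Strip Packing: an instance $(\mathcal{R},W)$ consists of a strip $[0,W]\times[0,\infty)$ with $W>0$ and a finite set $\mathcal{R}$ of $n$ axis-parallel closed rectangles; rectangle $r$ has width $w_r\in(0,W]$ and height $h_r>0$. A packing assigns to each $r$ a lower-left corner $(x_r,y_r)$; it is feasible if $x_r\ge0$, $x_r+w_r\le W$, $y_r\ge0$ and the open rectangles $(x_r,x_r+w_r)\times(y_r,y_r+h_r)$ are pairwise disjoint; no rotations. The height of a packing is $\max_r(y_r+h_r)$; $h_{\mathrm{OPT}}$ is the minimum height of a feasible packing and $h_{\max}=\max_{r\in\mathcal{R}}h_r$. Bottom-Left (BL) algorithm: given an ordering $r_1,\dots,r_n$, place $r_1$ at $(0,0)$; for $i\ge2$ choose $(x_{r_i},y_{r_i})$ such that $r_1,\dots,r_i$ form a feasible packing and $(y_{r_i},x_{r_i})$ is lexicographically minimal; $(x_r,y_r)$ denote the resulting positions and $h_{\mathrm{BL}}$ the height of the resulting packing. $\mathcal{FQW}$-partition: go through the rectangles in order of non-increasing height (ties arbitrary), adding $r$ to $\mathcal{F}$ (initially empty) iff $w_r+\sum_{f\in\mathcal{F}}w_f\le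 W$; $\mathcal{W}=\{r\in\mathcal{R}\setminus\mathcal{F}:w_r>W/2\}$, $\mathcal{Q}=\mathcal{R}\setminus(\mathcal{F}\cup\mathcal{W})$. The $\mathcal{FQW}$-ordering lists $\mathcal{F}$ by non-increasing height, then $\mathcal{Q}$ by non-increasing width, then $\mathcal{W}$ in any order; ties arbitrary.
   Formalization: The strip width W, the rectangle widths and heights, and the corner positions of every packing, including the Bottom-Left packing and the feasible packings it is compared with, are rational rather than real. -}

module Defs where

open import Data.Nat using (ℕ)
open import Data.Fin using (Fin)
open import Data.List using (List; []; _∷_; _++_; map; foldr; allFin)
open import Data.List.Membership.Propositional using (_∈_; _∉_)
open import Data.List.Relation.Unary.All using (All)
open import Data.List.Relation.Unary.AllPairs using (AllPairs)
open import Data.List.Relation.Binary.Permutation.Propositional using (_↭_)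
open import Data.Rational using (ℚ; 0ℚ; _+_; _*_; _≤_; _<_; _⊔_; _≤ᵇ_; ½)
open import Data.Bool using (if_then_else_)
open import Data.Product using (_×_)
open import Data.Sum using (_⊎_)
open import Relation.Binary.PropositionalEquality using (_≡_)

record Instance : Set where
  field
    n    : ℕ
    W    : ℚ
    w    : Fin n → ℚ
    h    : Fin n → ℚ
    W>0  : 0ℚ < W
    w>0  : ∀ r → 0ℚ < w r
    w≤W  : ∀ r → w r ≤ W
    h>0  : ∀ r → 0ℚ < h r

module _ (I : Instance) where
  open Instance I

  -- A placement: lower-left corners (x r, y r).
  Positions : Set
  Positions = Fin n → ℚ

  InStrip : Fin n → ℚ → ℚ → Set
  InStrip r a b = (0ℚ ≤ a) × (a + w r ≤ W) × (0ℚ ≤ b)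

  -- The open rectangles of r at (a , b) and s at (c , d) are disjoint
  -- (all sides positive, so this is exactly separation along some axis).
  Disjoint : Fin n → ℚ → ℚ → Fin n → ℚ → ℚ → Set
  Disjoint r a b s c d =
    (a + w r ≤ c) ⊎ (c + w s ≤ a) ⊎ (b + h r ≤ d) ⊎ (d + h s ≤ b)

  Feasible : Positions → Positions → Set
  Feasible x y =
    (∀ r → InStrip r (x r) (y r)) ×
    (∀ r s → r ≢ s → Disjoint r (x r) (y r) s (x s) (y s))
    where
    open import Relation.Binary.PropositionalEquality using (_≢_)

  maxOver : (Fin n → ℚ) → ℚ
  maxOver f = foldr _⊔_ 0ℚ (map f (allFin n))

  height : Positions → ℚ
  height y = maxOver (λ r → y r + h r)

  hmax : ℚ
  hmax = maxOver h

  Fits : List (Fin n) → Positions → Positions → Fin n → ℚ → ℚ → Set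
  Fits placed x y r a b =
    InStrip r a b × All (λ s → Disjoint r a b s (x s) (y s)) placed

  LexLe : ℚ → ℚ → ℚ → ℚ → Set
  LexLe b a b' a' = (b < b') ⊎ ((b ≡ b') × (a ≤ a'))

  -- (x , y) is the result of running Bottom-Left on the ordering, where
  -- 'placed' are the rectangles placed so far: every rectangle fits at its
  -- position w.r.t. the previously placed ones, and its position (y , x) is
  -- lexicographically minimal among all such feasible positions.
  -- (For the first rectangle this forces (0 , 0).)
  BLRun : List (Fin n) → Positions → Positions → List (Fin n) → Set
  BLRun placed x y []       = Data.Unit.⊤
    where import Data.Unit
  BLRun placed x y (r ∷ rs) =
    Fits placed x y r (x r) (y r) ×
    (∀ a b → Fits placed x y r a b → LexLe (y r) (x r) b a) ×
    BLRun (r ∷ placed) x y rs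

  IsBL : List (Fin n) → Positions → Positions → Set
  IsBL ord x y = BLRun [] x y ord

  IsOrdering : List (Fin n) → Set
  IsOrdering ord = ord ↭ allFin n

  IsHeightOrdering : List (Fin n) → Set
  IsHeightOrdering σ = IsOrdering σ × AllPairs (λ a b → h b ≤ h a) σ

  greedyF : ℚ → List (Fin n) → List (Fin n)
  greedyF acc []       = []
  greedyF acc (r ∷ rs) =
    if (w r + acc) ≤ᵇ W then r ∷ greedyF (acc + w r) rs else greedyF acc rs

  module FQW (σ : List (Fin n)) where
    Fset : List (Fin n)
    Fset = greedyF 0ℚ σ

    InF : Fin n → Set
    InF r = r ∈ Fset

    InW : Fin n → Set
    InW r = r ∉ Fset × (½ * W < w r)

    InQ : Fin n → Set
    InQ r = r ∉ Fset × (w r ≤ ½ * W)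

    IsFQWOrdering : List (Fin n) → Set
    IsFQWOrdering ord =
      IsOrdering ord ×
      Data.Product.∃ (λ Fs → Data.Product.∃ (λ Qs → Data.Product.∃ (λ Ws →
        (ord ≡ Fs ++ Qs ++ Ws) ×
        All InF Fs × All InQ Qs × All InW Ws ×
        AllPairs (λ a b → h b ≤ h a) Fs ×
        AllPairs (λ a b → w b ≤ w a) Qs)))
      where import Data.Product

-- Bottom-Left places the rectangles of F side by side on the floor, so they end below h_max,
-- and the rectangles of Q end below h_max by hypothesis.  Each wide rectangle could be placed
-- at the left wall directly above everything placed before it, so Bottom-Left puts it no
-- higher; hence h_BL ≤ h_max + Σ_{r ∈ W} h_r.  In any feasible packing two rectangles wider
-- than W/2 cannot stand side by side, so the wide rectangles are stacked vertically and
-- Σ_{r ∈ W} h_r ≤ h_OPT; together with h_max ≤ h_OPT this gives h_BL ≤ 2 h_OPT.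
module Submission where

open import Defs
open import Data.List using (List)
open import Data.Fin using (Fin)
open import Data.Rational using (ℚ; _≤_; _+_)
open import Data.Sum using (_⊎_)
open import Relation.Nullary using (¬_)

open import Data.Bool using (true; false; T)
open import Data.Empty using (⊥-elim)
open import Data.List using ([]; _∷_; _++_; _ʳ++_; map; foldr; allFin)
open import Data.List.Membership.Propositional using (_∈_)
open import Data.List.Membership.Propositional.Properties
  using (∈-allFin; ∈-++⁻; ∈-++⁺ˡ; ∈-++⁺ʳ; ∈-∃++)
open import Data.List.Relation.Unary.All as All using (All; []; _∷_)
import Data.List.Relation.Unary.All.Properties as All
open import Data.List.Relation.Unary.AllPairs using (AllPairs; []; _∷_)
open import Data.List.Relation.Unary.Any using (here; there)
open import Data.List.Relation.Unary.Unique.Propositional using (Unique)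
open import Data.List.Relation.Unary.Unique.Propositional.Properties using (allFin⁺)
open import Data.List.Relation.Binary.Permutation.Propositional using (↭-sym; ↭⇒↭ₛ)
open import Data.List.Relation.Binary.Permutation.Propositional.Properties using (∈-resp-↭)
import Data.List.Relation.Binary.Permutation.Setoid.Properties as Permutation
open import Data.Product using (_×_; _,_; proj₁; proj₂)
open import Data.Rational using (0ℚ; _<_; _⊔_; _*_; ½; _≤ᵇ_)
open import Data.Rational.Properties
open import Data.Rational.Solver using (module +-*-Solver)
open import Data.Sum using (inj₁; inj₂; [_,_]′)
open import Data.Unit using (tt)
open import Function using (_∘_)
open import Relation.Binary.PropositionalEquality
open import Relation.Nullary using (yes; no)
open import Relation.Nullary.Decidable using (_×-dec_)

p≤p+q : ∀ {p q} → 0ℚ ≤ q → p ≤ p + q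
p≤p+q {p} 0≤q = ≤-trans (≤-reflexive (sym (+-identityʳ p))) (+-monoʳ-≤ p 0≤q)

p≤q+p : ∀ {p q} → 0ℚ ≤ q → p ≤ q + p
p≤q+p {p} 0≤q = ≤-trans (≤-reflexive (sym (+-identityˡ p))) (+-monoˡ-≤ p 0≤q)

module _ {A : Set} (f : A → ℚ) where

  f≤foldr-⊔ : ∀ {a} xs → a ∈ xs → f a ≤ foldr _⊔_ 0ℚ (map f xs)
  f≤foldr-⊔ (b ∷ xs) (here refl) = p≤p⊔q (f b) _
  f≤foldr-⊔ (b ∷ xs) (there a∈xs) = p≤q⇒p≤r⊔q (f b) (f≤foldr-⊔ xs a∈xs)

  foldr-⊔-nonneg : ∀ xs → 0ℚ ≤ foldr _⊔_ 0ℚ (map f xs)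
  foldr-⊔-nonneg [] = ≤-refl
  foldr-⊔-nonneg (b ∷ xs) = p≤q⇒p≤r⊔q (f b) (foldr-⊔-nonneg xs)

  foldr-⊔-lub : ∀ {c} xs → 0ℚ ≤ c → All (λ a → f a ≤ c) xs → foldr _⊔_ 0ℚ (map f xs) ≤ c
  foldr-⊔-lub [] 0≤c [] = 0≤c
  foldr-⊔-lub (b ∷ xs) 0≤c (fb≤c ∷ fxs≤c) = ⊔-lub fb≤c (foldr-⊔-lub xs 0≤c fxs≤c)

module _ {A : Set} where

  sumOver : (A → ℚ) → List A → ℚ
  sumOver f [] = 0ℚ
  sumOver f (a ∷ xs) = f a + sumOver f xs

  sumOver-nonneg : ∀ {f} → (∀ a → 0ℚ ≤ f a) → ∀ xs → 0ℚ ≤ sumOver f xs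
  sumOver-nonneg f≥0 [] = ≤-refl
  sumOver-nonneg f≥0 (a ∷ xs) = ≤-trans (sumOver-nonneg f≥0 xs) (p≤q+p (f≥0 a))

  sumOver-mono : ∀ {f g xs} → All (λ a → f a ≤ g a) xs → sumOver f xs ≤ sumOver g xs
  sumOver-mono [] = ≤-refl
  sumOver-mono (fa≤ga ∷ fxs≤gxs) = +-mono-≤ fa≤ga (sumOver-mono fxs≤gxs)

  sumOver-+ : ∀ f g xs → sumOver (λ a → f a + g a) xs ≡ sumOver f xs + sumOver g xs
  sumOver-+ f g [] = sym (+-identityʳ 0ℚ)
  sumOver-+ f g (a ∷ xs) rewrite sumOver-+ f g xs =
    solve 4 (λ p q r s → (p :+ q) :+ (r :+ s) := (p :+ r) :+ (q :+ s))
      refl (f a) (g a) (sumOver f xs) (sumOver g xs)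
    where open +-*-Solver

  sumOver-++-∷ : ∀ f ys a zs → sumOver f (ys ++ a ∷ zs) ≡ f a + sumOver f (ys ++ zs)
  sumOver-++-∷ f [] a zs = refl
  sumOver-++-∷ f (b ∷ ys) a zs rewrite sumOver-++-∷ f ys a zs =
    solve 3 (λ p q r → p :+ (q :+ r) := q :+ (p :+ r))
      refl (f b) (f a) (sumOver f (ys ++ zs))
    where open +-*-Solver

  ∈-++-∷-remove : ∀ {a b : A} ys zs → a ≢ b → a ∈ ys ++ b ∷ zs → a ∈ ys ++ zs
  ∈-++-∷-remove ys zs a≢b a∈ with ∈-++⁻ ys a∈
  ... | inj₁ a∈ys = ∈-++⁺ˡ a∈ys
  ... | inj₂ (here a≡b) = ⊥-elim (a≢b a≡b)
  ... | inj₂ (there a∈zs) = ∈-++⁺ʳ ys a∈zs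

  sumOver-⊆ : ∀ {f} → (∀ a → 0ℚ ≤ f a) → ∀ {xs} ys → Unique xs → All (_∈ ys) xs →
              sumOver f xs ≤ sumOver f ys
  sumOver-⊆ f≥0 ys [] [] = sumOver-nonneg f≥0 ys
  sumOver-⊆ {f} f≥0 {a ∷ xs} ys (a∉xs ∷ xs!) (a∈ys ∷ xs⊆ys) with ∈-∃++ a∈ys
  ... | us , vs , refl = begin
      f a + sumOver f xs         ≤⟨ +-monoʳ-≤ (f a) (sumOver-⊆ f≥0 (us ++ vs) xs! (remove a∉xs xs⊆ys)) ⟩
      f a + sumOver f (us ++ vs) ≡⟨ sym (sumOver-++-∷ f us a vs) ⟩
      sumOver f (us ++ a ∷ vs)   ∎
    where
    open ≤-Reasoning
    remove : ∀ {zs} → All (a ≢_) zs → All (_∈ us ++ a ∷ vs) zs → All (_∈ us ++ vs) zs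
    remove [] [] = []
    remove (a≢b ∷ a≢zs) (b∈ ∷ zs⊆) = ∈-++-∷-remove us vs (a≢b ∘ sym) b∈ ∷ remove a≢zs zs⊆

AllPairs-++⁻ˡ : ∀ {A : Set} {R : A → A → Set} xs {ys} → AllPairs R (xs ++ ys) → AllPairs R xs
AllPairs-++⁻ˡ [] _ = []
AllPairs-++⁻ˡ (a ∷ xs) (Ra ∷ Rxs) = All.++⁻ˡ xs Ra ∷ AllPairs-++⁻ˡ xs Rxs

AllPairs-++⁻ʳ : ∀ {A : Set} {R : A → A → Set} xs {ys} → AllPairs R (xs ++ ys) → AllPairs R ys
AllPairs-++⁻ʳ [] Rys = Rys
AllPairs-++⁻ʳ (a ∷ xs) (_ ∷ Rxs) = AllPairs-++⁻ʳ xs Rxs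

All-ʳ++⁺ : ∀ {A : Set} {P : A → Set} {xs ys} → All P xs → All P ys → All P (xs ʳ++ ys)
All-ʳ++⁺ [] Pys = Pys
All-ʳ++⁺ (Pa ∷ Pxs) Pys = All-ʳ++⁺ Pxs (Pa ∷ Pys)

module Stacking {A : Set} (bot len : A → ℚ) (len≥0 : ∀ a → 0ℚ ≤ len a) where

  top : A → ℚ
  top a = bot a + len a

  Inside : ℚ → ℚ → A → Set
  Inside lo hi a = lo ≤ bot a × top a ≤ hi

  Stacked : A → A → Set
  Stacked a b = top a ≤ bot b ⊎ top b ≤ bot a

  -- Counting only the intervals inside [lo, hi] lets the induction below split [lo, hi]
  -- at any interval without filtering the list.
  lenInside : ℚ → ℚ → A → ℚ
  lenInside lo hi a with (lo ≤? bot a) ×-dec (top a ≤? hi)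
  ... | yes _ = len a
  ... | no _ = 0ℚ

  lenInside-inside : ∀ {lo hi a} → Inside lo hi a → lenInside lo hi a ≡ len a
  lenInside-inside {lo} {hi} {a} inside with (lo ≤? bot a) ×-dec (top a ≤? hi)
  ... | yes _ = refl
  ... | no outside = ⊥-elim (outside inside)

  lenInside-nonneg : ∀ lo hi a → 0ℚ ≤ lenInside lo hi a
  lenInside-nonneg lo hi a with (lo ≤? bot a) ×-dec (top a ≤? hi)
  ... | yes _ = len≥0 a
  ... | no _ = ≤-refl

  lenInside-split : ∀ lo hi b a → Stacked b a →
                    lenInside lo hi a ≤ lenInside lo (bot b) a + lenInside (top b) hi a
  lenInside-split lo hi b a stacked with (lo ≤? bot a) ×-dec (top a ≤? hi)
  ... | no _ = +-mono-≤ (lenInside-nonneg lo (bot b) a) (lenInside-nonneg (top b) hi a)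
  ... | yes (lo≤a , a≤hi) with stacked
  ...   | inj₁ b≤a = ≤-trans (p≤q+p (lenInside-nonneg lo (bot b) a))
                       (≤-reflexive (cong (lenInside lo (bot b) a +_) (sym (lenInside-inside (b≤a , a≤hi)))))
  ...   | inj₂ a≤b = ≤-trans (p≤p+q (lenInside-nonneg (top b) hi a))
                       (≤-reflexive (cong (_+ lenInside (top b) hi a) (sym (lenInside-inside (lo≤a , a≤b)))))

  lo+sumLenInside≤hi : ∀ {lo hi} xs → AllPairs Stacked xs → lo ≤ hi →
                       lo + sumOver (lenInside lo hi) xs ≤ hi
  lo+sumLenInside≤hi {lo} [] [] lo≤hi = ≤-trans (≤-reflexive (+-identityʳ lo)) lo≤hi
  lo+sumLenInside≤hi {lo} {hi} (b ∷ xs) (b-stacked ∷ xs-stacked) lo≤hi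
    with (lo ≤? bot b) ×-dec (top b ≤? hi)
  ... | no _ = ≤-trans (≤-reflexive (cong (lo +_) (+-identityˡ _)))
                 (lo+sumLenInside≤hi xs xs-stacked lo≤hi)
  ... | yes (lo≤b , b≤hi) = begin
      lo + (len b + sumOver (lenInside lo hi) xs)   ≤⟨ +-monoʳ-≤ lo (+-monoʳ-≤ (len b) split) ⟩
      lo + (len b + (below + above))                 ≡⟨ rearrange lo (len b) below above ⟩
      (lo + below) + (len b + above)                 ≤⟨ +-monoˡ-≤ (len b + above)
                                                          (lo+sumLenInside≤hi xs xs-stacked lo≤b) ⟩
      bot b + (len b + above)                        ≡⟨ sym (+-assoc (bot b) (len b) above) ⟩
      top b + above                                  ≤⟨ lo+sumLenInside≤hi xs xs-stacked b≤hi ⟩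
      hi                                             ∎
    where
    open ≤-Reasoning
    below = sumOver (lenInside lo (bot b)) xs
    above = sumOver (lenInside (top b) hi) xs
    split : sumOver (lenInside lo hi) xs ≤ below + above
    split = ≤-trans (sumOver-mono (All.map (lenInside-split lo hi b _) b-stacked))
                    (≤-reflexive (sumOver-+ (lenInside lo (bot b)) (lenInside (top b) hi) xs))
    rearrange : ∀ p q r s → p + (q + (r + s)) ≡ (p + r) + (q + s)
    rearrange = solve 4 (λ p q r s → p :+ (q :+ (r :+ s)) := (p :+ r) :+ (q :+ s)) refl
      where open +-*-Solver

  lo+sumLen≤hi : ∀ {lo hi xs} → AllPairs Stacked xs → All (Inside lo hi) xs → lo ≤ hi →
                 lo + sumOver len xs ≤ hi
  lo+sumLen≤hi {lo} {hi} {xs} stacked inside lo≤hi =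
    ≤-trans (+-monoʳ-≤ lo (sumOver-mono (All.map (≤-reflexive ∘ sym ∘ lenInside-inside) inside)))
            (lo+sumLenInside≤hi xs stacked lo≤hi)

module _ (I : Instance) where
  open Instance I

  w≥0 : ∀ r → 0ℚ ≤ w r
  w≥0 r = <⇒≤ (w>0 r)

  h≥0 : ∀ r → 0ℚ ≤ h r
  h≥0 r = <⇒≤ (h>0 r)

  f≤maxOver : ∀ f r → f r ≤ maxOver I f
  f≤maxOver f r = f≤foldr-⊔ f (allFin n) (∈-allFin r)

  maxOver-nonneg : ∀ f → 0ℚ ≤ maxOver I f
  maxOver-nonneg f = foldr-⊔-nonneg f (allFin n)

  maxOver-lub : ∀ f {c} → 0ℚ ≤ c → (∀ r → f r ≤ c) → maxOver I f ≤ c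
  maxOver-lub f 0≤c f≤c = foldr-⊔-lub f (allFin n) 0≤c (All.tabulate (λ {r} _ → f≤c r))

  unique-ordering : ∀ {ord} → IsOrdering I ord → Unique ord
  unique-ordering ordering =
    Permutation.Unique-resp-↭ (setoid (Fin n)) (↭⇒↭ₛ (↭-sym ordering)) (allFin⁺ n)

  greedyF-width : ∀ acc rs → acc ≤ W → acc + sumOver w (greedyF I acc rs) ≤ W
  greedyF-width acc [] acc≤W = ≤-trans (≤-reflexive (+-identityʳ acc)) acc≤W
  greedyF-width acc (r ∷ rs) acc≤W with (w r + acc) ≤ᵇ W in fits
  ... | true = ≤-trans (≤-reflexive (sym (+-assoc acc (w r) _))) (greedyF-width (acc + w r) rs acc+r≤W)
    where
    acc+r≤W : acc + w r ≤ W
    acc+r≤W = ≤-trans (≤-reflexive (+-comm acc (w r))) (≤ᵇ⇒≤ (subst T (sym fits) tt))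
  ... | false = greedyF-width acc rs acc≤W

  LexLe⇒≤ : ∀ {b a b' a'} → LexLe I b a b' a' → b ≤ b'
  LexLe⇒≤ (inj₁ b<b') = <⇒≤ b<b'
  LexLe⇒≤ (inj₂ (b≡b' , _)) = ≤-reflexive b≡b'

  module BottomLeft (x y : Positions I) where

    BLRun-++⁻ˡ : ∀ rs {ss placed} → BLRun I placed x y (rs ++ ss) → BLRun I placed x y rs
    BLRun-++⁻ˡ [] _ = tt
    BLRun-++⁻ˡ (r ∷ rs) (fits , lowest , run) = fits , lowest , BLRun-++⁻ˡ rs run

    BLRun-++⁻ʳ : ∀ rs {ss placed} → BLRun I placed x y (rs ++ ss) → BLRun I (rs ʳ++ placed) x y ss
    BLRun-++⁻ʳ [] run = run
    BLRun-++⁻ʳ (r ∷ rs) (_ , _ , run) = BLRun-++⁻ʳ rs run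

    side-by-side-on-floor : ∀ rs {placed} S → 0ℚ ≤ S → All (λ s → x s + w s ≤ S) placed →
                            S + sumOver w rs ≤ W → BLRun I placed x y rs → All (λ r → y r ≡ 0ℚ) rs
    side-by-side-on-floor [] S _ _ _ _ = []
    side-by-side-on-floor (r ∷ rs) {placed} S 0≤S left-of-S row≤W (fits , lowest , run)
      with lowest S 0ℚ fits-at-S
      where
      fits-at-S : Fits I placed x y r S 0ℚ
      fits-at-S = (0≤S , ≤-trans (+-monoʳ-≤ S (p≤p+q (sumOver-nonneg w≥0 rs))) row≤W , ≤-refl)
                , All.map (inj₂ ∘ inj₁) left-of-S
    ... | inj₁ yr<0 = ⊥-elim (<-irrefl refl (<-≤-trans yr<0 (proj₂ (proj₂ (proj₁ fits)))))
    ... | inj₂ (yr≡0 , xr≤S) =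
      yr≡0 ∷ side-by-side-on-floor rs (S + w r) (≤-trans 0≤S (p≤p+q (w≥0 r)))
               (+-monoˡ-≤ (w r) xr≤S ∷ All.map (λ s≤S → ≤-trans s≤S (p≤p+q (w≥0 r))) left-of-S)
               (≤-trans (≤-reflexive (+-assoc S (w r) (sumOver w rs))) row≤W) run

    tops-≤-level+heights : ∀ rs {placed} T → 0ℚ ≤ T → All (λ s → y s + h s ≤ T) placed →
                           BLRun I placed x y rs → All (λ r → y r + h r ≤ T + sumOver h rs) rs
    tops-≤-level+heights [] T _ _ _ = []
    tops-≤-level+heights (r ∷ rs) {placed} T 0≤T below-T (_ , lowest , run) =
      ≤-trans r-top≤ (+-monoʳ-≤ T (p≤p+q (sumOver-nonneg h≥0 rs)))
      ∷ All.map (λ top≤ → ≤-trans top≤ (≤-reflexive (+-assoc T (h r) (sumOver h rs))))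
          (tops-≤-level+heights rs (T + h r) (≤-trans 0≤T (p≤p+q (h≥0 r)))
            (r-top≤ ∷ All.map (λ top≤ → ≤-trans top≤ (p≤p+q (h≥0 r))) below-T) run)
      where
      fits-at-T : Fits I placed x y r 0ℚ T
      fits-at-T = (≤-refl , ≤-trans (≤-reflexive (+-identityˡ (w r))) (w≤W r) , 0≤T)
                , All.map (inj₂ ∘ inj₂ ∘ inj₂) below-T
      r-top≤ : y r + h r ≤ T + h r
      r-top≤ = +-monoˡ-≤ (h r) (LexLe⇒≤ (lowest 0ℚ T fits-at-T))

  module LowerBounds (x' y' : Positions I) (feasible : Feasible I x' y') where
    open Stacking y' h h≥0

    top≤height : ∀ r → top r ≤ height I y'
    top≤height = f≤maxOver top

    hmax≤height : hmax I ≤ height I y'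
    hmax≤height = maxOver-lub h (maxOver-nonneg top)
      (λ r → ≤-trans (p≤q+p (proj₂ (proj₂ (proj₁ feasible r)))) (top≤height r))

    Wide : Fin n → Set
    Wide r = ½ * W < w r

    wide-not-beside : ∀ {r s} → Wide r → Wide s → ¬ (x' r + w r ≤ x' s)
    wide-not-beside {r} {s} wide-r wide-s r-left-of-s = <-irrefl refl (<-≤-trans W<wr+ws wr+ws≤W)
      where
      W<wr+ws : W < w r + w s
      W<wr+ws = subst (_< w r + w s) (trans (sym (*-distribʳ-+ W ½ ½)) (*-identityˡ W))
                      (+-mono-< wide-r wide-s)
      wr+ws≤W : w r + w s ≤ W
      wr+ws≤W = ≤-trans (+-monoˡ-≤ (w s) (≤-trans (p≤q+p (proj₁ (proj₁ feasible r))) r-left-of-s))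
                        (proj₁ (proj₂ (proj₁ feasible s)))

    wide-stacked : ∀ {r s} → Wide r → Wide s → r ≢ s → Stacked r s
    wide-stacked {r} {s} wide-r wide-s r≢s with proj₂ feasible r s r≢s
    ... | inj₁ r-left-of-s = ⊥-elim (wide-not-beside wide-r wide-s r-left-of-s)
    ... | inj₂ (inj₁ s-left-of-r) = ⊥-elim (wide-not-beside wide-s wide-r s-left-of-r)
    ... | inj₂ (inj₂ stacked) = stacked

    sumOver-wide≤height : ∀ {rs} → Unique rs → All Wide rs → sumOver h rs ≤ height I y'
    sumOver-wide≤height {rs} unique wide =
      ≤-trans (≤-reflexive (sym (+-identityˡ (sumOver h rs))))
              (lo+sumLen≤hi (pairwise-stacked unique wide) inside (maxOver-nonneg top))
      where
      pairwise-stacked : ∀ {rs} → Unique rs → All Wide rs → AllPairs Stacked rs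
      pairwise-stacked [] [] = []
      pairwise-stacked (r∉rs ∷ unique) (wide-r ∷ wide) =
        All.zipWith (λ (r≢s , wide-s) → wide-stacked wide-r wide-s r≢s) (r∉rs , wide)
        ∷ pairwise-stacked unique wide
      inside : All (Inside 0ℚ (height I y')) rs
      inside = All.tabulate (λ {r} _ → proj₂ (proj₂ (proj₁ feasible r)) , top≤height r)

  module _ (σ : List (Fin n)) where
    open FQW I σ

    widths-F≤W : ∀ {Fs} → Unique Fs → All InF Fs → sumOver w Fs ≤ W
    widths-F≤W unique inF = ≤-trans (sumOver-⊆ w≥0 Fset unique inF)
      (≤-trans (≤-reflexive (sym (+-identityˡ _))) (greedyF-width 0ℚ σ (<⇒≤ W>0)))

    height≤hmax+heights-W : ∀ {Fs Qs Ws x y} → IsOrdering I (Fs ++ Qs ++ Ws) →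
      IsBL I (Fs ++ Qs ++ Ws) x y → All InF Fs → All (λ r → y r + h r ≤ hmax I) Qs →
      height I y ≤ hmax I + sumOver h Ws
    height≤hmax+heights-W {Fs} {Qs} {Ws} {x} {y} ordering bl inF Q-low =
      maxOver-lub _ (≤-trans (maxOver-nonneg h) (p≤p+q (sumOver-nonneg h≥0 Ws)))
        (λ r → All.lookup every-top (∈-resp-↭ (↭-sym ordering) (∈-allFin r)))
      where
      open BottomLeft x y
      bound = hmax I + sumOver h Ws

      F-floor : All (λ r → y r ≡ 0ℚ) Fs
      F-floor = side-by-side-on-floor Fs 0ℚ ≤-refl []
        (≤-trans (≤-reflexive (+-identityˡ _))
                 (widths-F≤W (AllPairs-++⁻ˡ Fs (unique-ordering ordering)) inF))
        (BLRun-++⁻ˡ Fs bl)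

      F-low : All (λ r → y r + h r ≤ hmax I) Fs
      F-low = All.map (λ {r} yr≡0 → ≤-trans (≤-reflexive (trans (cong (_+ h r) yr≡0) (+-identityˡ (h r))))
                                            (f≤maxOver h r)) F-floor

      W-stacked : All (λ r → y r + h r ≤ bound) Ws
      W-stacked = tops-≤-level+heights Ws (hmax I) (maxOver-nonneg h)
        (All-ʳ++⁺ Q-low (All-ʳ++⁺ F-low [])) (BLRun-++⁻ʳ Qs (BLRun-++⁻ʳ Fs bl))

      weaken : ∀ {r} → y r + h r ≤ hmax I → y r + h r ≤ bound
      weaken top≤ = ≤-trans top≤ (p≤p+q (sumOver-nonneg h≥0 Ws))

      every-top : All (λ r → y r + h r ≤ bound) (Fs ++ Qs ++ Ws)
      every-top = All.++⁺ (All.map weaken F-low) (All.++⁺ (All.map weaken Q-low) W-stacked)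

lemma4 : (I : Instance) → let open Instance I in
    (σ : List (Fin n)) → IsHeightOrdering I σ →
    (ord : List (Fin n)) → FQW.IsFQWOrdering I σ ord →
    (x y : Positions I) → IsBL I ord x y →
    ((∀ r → ¬ FQW.InQ I σ r) ⊎
     (∀ r → FQW.InQ I σ r → y r + h r ≤ hmax I)) →
    (x' y' : Positions I) → Feasible I x' y' →
    height I y ≤ height I y' + height I y'
lemma4 I σ _ _ (ordering , Fs , Qs , Ws , refl , inF , inQ , inW , _ , _) x y bl Q-empty-or-low x' y' feasible =
  begin
    height I y                  ≤⟨ height≤hmax+heights-W I σ ordering bl inF Q-low ⟩
    hmax I + sumOver h Ws       ≤⟨ +-mono-≤ hmax≤height (sumOver-wide≤height unique-W (All.map proj₂ inW)) ⟩
    height I y' + height I y'   ∎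
  where
  open Instance I
  open LowerBounds I x' y' feasible
  open ≤-Reasoning

  Q-low : All (λ r → y r + h r ≤ hmax I) Qs
  Q-low = [ (λ no-Q → All.map (λ {r} r∈Q → ⊥-elim (no-Q r r∈Q)) inQ)
          , (λ low → All.map (λ {r} → low r) inQ) ]′ Q-empty-or-low

  unique-W : Unique Ws
  unique-W = AllPairs-++⁻ʳ Qs (AllPairs-++⁻ʳ Fs (unique-ordering I ordering))
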